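{- Let $\Sigma=(K_n,\sigma)$ be a signed complete graph on $n$ vertices and let $B$ be a negation set of $\Sigma$. If $n-|V(B)|\ge \chi'(B)$, then $B$ is a minimum negation set of $\Sigma$.
   Context: A signed graph is a pair $(\Gamma,\sigma)$ with $\Gamma$ a simple graph and $\sigma: E(\Gamma)\to\{+,-\}$. The sign of a circle (cycle) is the product of the signs of its edges; the signed graph is balanced if every circle is positive. A negation set is a set of edges whose negation (changing the sign of each of its edges) yields a balanced signed graph; it is minimum if no negation set has fewer edges. For an edge set $B$, $V(B)$ denotes the set of vertices incident with at least one edge of $B$, and $\chi'(B)$ denotes the chromatic index (edge-chromatic number) of the graph $(V(B),B)$. -}

module Defs where

open import Data.Nat using (ℕ; _<_; _≤_; _∸_)
open import Data.Bool using (Bool; true; false; _xor_; _∧_; not; if_then_else_)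
open import Data.Fin using (Fin; _≟_; _<?_)
open import Data.List using (List; []; _∷_; _++_; [_]; length; map; concatMap; filter)
open import Data.Nat.ListAction using (sum)
open import Data.Bool.ListAction using (any)
open import Data.List.Relation.Unary.Unique.Propositional using (Unique)
open import Data.Product using (Σ; _×_; _,_; proj₁; proj₂)
open import Data.List using (allFin)
open import Relation.Nullary using (¬_)
open import Relation.Nullary.Decidable using (⌊_⌋)
open import Relation.Binary.PropositionalEquality using (_≡_; _≢_)

-- A signature on the complete graph K_n with vertex set Fin n:
-- σ i j = true means the edge {i,j} is negative, false means positive.
-- Only off-diagonal values matter; symmetry is imposed as a hypothesis.
Signature : ℕ → Set
Signature n = Fin n → Fin n → Bool

SymmetricSig : ∀ {n} → Signature n → Set
SymmetricSig {n} s = ∀ (i j : Fin n) → s i j ≡ s j i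

-- An edge set of K_n: b i j = true means {i,j} ∈ B (for i ≠ j; the diagonal is ignored).
EdgeSet : ℕ → Set
EdgeSet n = Fin n → Fin n → Bool

pathSign : ∀ {n} → Signature n → List (Fin n) → Bool
pathSign s [] = false
pathSign s (x ∷ []) = false
pathSign s (x ∷ y ∷ r) = s x y xor pathSign s (y ∷ r)

circleSign : ∀ {n} → Signature n → List (Fin n) → Bool
circleSign s [] = false
circleSign s (x ∷ r) = pathSign s ((x ∷ r) ++ [ x ])

-- circles of K_n: lists of ≥ 3 distinct vertices (consecutive ones and
-- last/first are adjacent, since the graph is complete)
Balanced : ∀ {n} → Signature n → Set
Balanced {n} s = ∀ (vs : List (Fin n)) → Unique vs → 3 ≤ length vs → circleSign s vs ≡ false

negate : ∀ {n} → Signature n → EdgeSet n → Signature n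
negate s b i j = s i j xor b i j

IsNegationSet : ∀ {n} → Signature n → EdgeSet n → Set
IsNegationSet s b = Balanced (negate s b)

-- pairs (i , j) with i < j, i.e. the edges of K_n
upperPairs : (n : ℕ) → List (Fin n × Fin n)
upperPairs n = filter (λ p → proj₁ p <? proj₂ p)
  (concatMap (λ i → map (λ j → (i , j)) (allFin n)) (allFin n))

edgeCount : ∀ {n} → EdgeSet n → ℕ
edgeCount {n} b = sum (map (λ p → if b (proj₁ p) (proj₂ p) then 1 else 0) (upperPairs n))

covered : ∀ {n} → EdgeSet n → Fin n → Bool
covered {n} b i = any (λ j → b i j ∧ not ⌊ i ≟ j ⌋) (allFin n)

vertexCount : ∀ {n} → EdgeSet n → ℕ
vertexCount {n} b = sum (map (λ i → if covered b i then 1 else 0) (allFin n))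

-- a proper edge colouring of (V(B),B) with colours {0,…,k-1}
-- (c i j is the colour of the edge {i,j}; values off B are irrelevant)
Colorable : ∀ {n} → EdgeSet n → ℕ → Set
Colorable {n} b k =
  Σ (Fin n → Fin n → ℕ) λ c →
    (∀ i j → c i j ≡ c j i) ×
    (∀ i j → i ≢ j → b i j ≡ true → c i j < k) ×
    (∀ i j l → i ≢ j → i ≢ l → j ≢ l → b i j ≡ true → b i l ≡ true → c i j ≢ c i l)

IsChromaticIndex : ∀ {n} → EdgeSet n → ℕ → Set
IsChromaticIndex b k = Colorable b k × (∀ m → Colorable b m → k ≤ m)

SymmetricEdges : ∀ {n} → EdgeSet n → Set
SymmetricEdges {n} b = ∀ (i j : Fin n) → b i j ≡ b j i

IsMinimumNegationSet : ∀ {n} → Signature n → EdgeSet n → Set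
IsMinimumNegationSet {n} s b =
  IsNegationSet s b ×
  (∀ (b' : EdgeSet n) → SymmetricEdges b' → IsNegationSet s b' → edgeCount b ≤ edgeCount b')

-- If B and B' are negation sets of the same signed graph, their symmetric difference D is a
-- negation set of the all-positive graph, i.e. a cut: every triangle meets D evenly.  Give the
-- edges of B a proper colouring with χ colours and assign to each colour c its own vertex w_c
-- outside V(B).  An edge ij of B ∩ D of colour c spans a triangle with w_c, so exactly one of
-- w_c i and w_c j lies in D; that edge is in D ∖ B, since w_c is isolated in B.  This edge
-- determines w_c (its endpoint outside V(B)), hence c, and its other endpoint v; as colour
-- classes are matchings, ij is the only edge of colour c at v.  So |B ∩ D| ≤ |D ∖ B| = |B' ∩ D|,
-- and therefore |B| ≤ |B'|.
module Submission where

open import Defs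
open import Data.Nat using (ℕ; _≤_; _∸_)
open import Data.Nat using (zero; suc; _+_; _<_; s≤s; z≤n)
open import Data.Nat.Properties using (+-suc; +-monoˡ-≤; m+n∸m≡n; ≮⇒≥; <-≤-trans; module ≤-Reasoning)
open import Data.Nat.ListAction using (sum)
open import Data.Bool using (Bool; true; false; not; _∧_; _xor_; if_then_else_; T?)
open import Data.Bool.Properties
  using (xor-∧-commutativeRing; xor-same; ∧-conicalˡ; ∧-conicalʳ; T-≡; T-not-≡; T-∧)
open import Data.Fin as Fin using (Fin; _<?_; _≟_; toℕ; fromℕ<)
open import Data.Fin.Properties using (<-asym; <⇒≢; ≤∧≢⇒<; ≤-antisym; injective⇒≤; toℕ-fromℕ<)
open import Data.List using (List; []; _∷_; _++_; length; map; concatMap; filter; filterᵇ; allFin;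
  lookup; cartesianProduct)
open import Data.List.Properties using (map-cong; length-tabulate)
open import Data.List.Relation.Unary.All as All using ([]; _∷_)
open import Data.List.Relation.Unary.AllPairs using ([]; _∷_)
open import Data.List.Relation.Unary.Any using (index)
open import Data.List.Relation.Unary.Any.Properties using (any⁺)
open import Data.List.Relation.Unary.Unique.Propositional using (Unique)
import Data.List.Relation.Unary.Unique.Propositional.Properties as Unique
open import Data.List.Membership.Propositional using (_∈_; lose)
open import Data.List.Membership.Propositional.Properties
  using (∈-filter⁺; ∈-filter⁻; ∈-lookup; ∈-allFin; ∈-cartesianProduct⁺)
open import Data.List.Membership.Setoid.Properties using (index-injective)
open import Data.Product using (_×_; _,_; proj₁; proj₂)
open import Data.Product.Properties using (,-injective)
open import Data.Sum using (_⊎_; inj₁; inj₂)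
open import Function using (_∘_; Equivalence)
open import Relation.Nullary using (yes; no; contradiction)
open import Relation.Nullary.Decidable using (⌊_⌋; fromWitnessFalse)
open import Relation.Binary.PropositionalEquality
  using (_≡_; _≢_; refl; sym; trans; cong; cong₂; subst; subst₂; setoid; module ≡-Reasoning)
open import Algebra.Bundles using (CommutativeRing)
open import Algebra.Properties.CommutativeSemigroup
  (CommutativeRing.+-commutativeSemigroup xor-∧-commutativeRing) using (interchange)

private
  variable
    A : Set
    n : ℕ

open Equivalence

count : (A → Bool) → List A → ℕ
count p xs = sum (map (λ x → if p x then 1 else 0) xs)

count-cong : ∀ {p q : A → Bool} xs → (∀ x → p x ≡ q x) → count p xs ≡ count q xs
count-cong xs p≗q = cong sum (map-cong (λ x → cong (λ b → if b then 1 else 0) (p≗q x)) xs)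

count-split : ∀ (p q : A → Bool) xs →
  count p xs ≡ count (λ x → p x ∧ q x) xs + count (λ x → p x ∧ not (q x)) xs
count-split p q [] = refl
count-split p q (x ∷ xs) with p x | q x
... | true  | true  = cong suc (count-split p q xs)
... | true  | false = trans (cong suc (count-split p q xs)) (sym (+-suc _ _))
... | false | _     = count-split p q xs

count-complement : ∀ (p : A → Bool) xs → count p xs + count (not ∘ p) xs ≡ length xs
count-complement p [] = refl
count-complement p (x ∷ xs) with p x
... | true  = cong suc (count-complement p xs)
... | false = trans (+-suc _ _) (cong suc (count-complement p xs))

count≡length-filterᵇ : ∀ (p : A → Bool) xs → count p xs ≡ length (filterᵇ p xs)
count≡length-filterᵇ p [] = refl
count≡length-filterᵇ p (x ∷ xs) with p x
... | true  = cong suc (count≡length-filterᵇ p xs)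
... | false = count≡length-filterᵇ p xs

lookup-injective : ∀ {xs : List A} → Unique xs → ∀ i j → lookup xs i ≡ lookup xs j → i ≡ j
lookup-injective (_   ∷ _)  Fin.zero    Fin.zero    _ = refl
lookup-injective (x∉ ∷ _)  Fin.zero    (Fin.suc j) e = contradiction e (All.lookup x∉ (∈-lookup j))
lookup-injective (x∉ ∷ _)  (Fin.suc i) Fin.zero    e = contradiction (sym e) (All.lookup x∉ (∈-lookup i))
lookup-injective (_   ∷ u) (Fin.suc i) (Fin.suc j) e = cong Fin.suc (lookup-injective u i j e)

count-mono-injection : ∀ {p q : A → Bool} {xs} (f : A → A) → Unique xs →
  (∀ {x} → x ∈ xs → p x ≡ true → f x ∈ xs × q (f x) ≡ true) →
  (∀ {x y} → x ∈ xs → y ∈ xs → p x ≡ true → p y ≡ true → f x ≡ f y → x ≡ y) →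
  count p xs ≤ count q xs
count-mono-injection {A} {p} {q} {xs} f xs! f-into f-injective =
  subst₂ _≤_ (sym (count≡length-filterᵇ p xs)) (sym (count≡length-filterᵇ q xs))
    (injective⇒≤ {f = ι} ι-injective)
  where
  P : List A
  P = filterᵇ p xs

  source : ∀ i → lookup P i ∈ xs × p (lookup P i) ≡ true
  source i with ∈-filter⁻ (T? ∘ p) (∈-lookup i)
  ... | x∈xs , px = x∈xs , to T-≡ px

  target : ∀ i → f (lookup P i) ∈ filterᵇ q xs
  target i with f-into (proj₁ (source i)) (proj₂ (source i))
  ... | fx∈xs , qfx = ∈-filter⁺ (T? ∘ q) fx∈xs (from T-≡ qfx)

  ι : Fin (length P) → Fin (length (filterᵇ q xs))
  ι i = index (target i)

  ι-injective : ∀ {i j} → ι i ≡ ι j → i ≡ j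
  ι-injective {i} {j} e = lookup-injective (Unique.filter⁺ (T? ∘ p) xs!) i j
    (f-injective (proj₁ (source i)) (proj₁ (source j)) (proj₂ (source i)) (proj₂ (source j))
      (index-injective (setoid A) (target i) (target j) e))

lookupOr : A → List A → ℕ → A
lookupOr d []       k       = d
lookupOr d (x ∷ xs) zero    = x
lookupOr d (x ∷ xs) (suc k) = lookupOr d xs k

lookupOr≡lookup : ∀ {d : A} xs {k} (k<∣xs∣ : k < length xs) →
  lookupOr d xs k ≡ lookup xs (fromℕ< k<∣xs∣)
lookupOr≡lookup (x ∷ xs) {zero}  _            = refl
lookupOr≡lookup (x ∷ xs) {suc k} (s≤s k<∣xs∣) = lookupOr≡lookup xs k<∣xs∣

lookupOr-∈ : ∀ {d : A} {xs k} → k < length xs → lookupOr d xs k ∈ xs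
lookupOr-∈ {xs = xs} k<∣xs∣ = subst (_∈ xs) (sym (lookupOr≡lookup xs k<∣xs∣)) (∈-lookup _)

lookupOr-injective : ∀ {d d' : A} {xs k l} → Unique xs → (k<∣xs∣ : k < length xs) →
  (l<∣xs∣ : l < length xs) → lookupOr d xs k ≡ lookupOr d' xs l → k ≡ l
lookupOr-injective {xs = xs} {k} {l} xs! k<∣xs∣ l<∣xs∣ e = begin
  k                         ≡⟨ toℕ-fromℕ< k<∣xs∣ ⟨
  toℕ (fromℕ< k<∣xs∣)      ≡⟨ cong toℕ (lookup-injective xs! _ _ lookups≡) ⟩
  toℕ (fromℕ< l<∣xs∣)      ≡⟨ toℕ-fromℕ< l<∣xs∣ ⟩
  l                         ∎
  where
  open ≡-Reasoning
  lookups≡ : lookup xs (fromℕ< k<∣xs∣) ≡ lookup xs (fromℕ< l<∣xs∣)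
  lookups≡ = trans (sym (lookupOr≡lookup xs k<∣xs∣)) (trans e (lookupOr≡lookup xs l<∣xs∣))

-- Edges of K_n as sorted pairs

upperPairs≡ : ∀ n → upperPairs n ≡
  filter (λ e → proj₁ e <? proj₂ e) (cartesianProduct (allFin n) (allFin n))
upperPairs≡ n = cong (filter (λ e → proj₁ e <? proj₂ e)) (concatMap≡cartesianProduct (allFin n))
  where
  concatMap≡cartesianProduct : (xs : List (Fin n)) →
    concatMap (λ i → map (i ,_) (allFin n)) xs ≡ cartesianProduct xs (allFin n)
  concatMap≡cartesianProduct []       = refl
  concatMap≡cartesianProduct (x ∷ xs) = cong (map (x ,_) (allFin n) ++_) (concatMap≡cartesianProduct xs)

∈-upperPairs⁺ : ∀ {i j : Fin n} → i Fin.< j → (i , j) ∈ upperPairs n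
∈-upperPairs⁺ {n} {i} {j} i<j rewrite upperPairs≡ n =
  ∈-filter⁺ (λ e → proj₁ e <? proj₂ e) (∈-cartesianProduct⁺ (∈-allFin i) (∈-allFin j)) i<j

∈-upperPairs⁻ : ∀ {i j : Fin n} → (i , j) ∈ upperPairs n → i Fin.< j
∈-upperPairs⁻ {n} ij∈ rewrite upperPairs≡ n =
  proj₂ (∈-filter⁻ (λ e → proj₁ e <? proj₂ e) {xs = cartesianProduct (allFin n) (allFin n)} ij∈)

upperPairs-unique : ∀ n → Unique (upperPairs n)
upperPairs-unique n rewrite upperPairs≡ n = Unique.filter⁺ (λ e → proj₁ e <? proj₂ e)
  (Unique.cartesianProduct⁺ (Unique.allFin⁺ n) (Unique.allFin⁺ n))

edge : Fin n → Fin n → Fin n × Fin n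
edge i j with i <? j
... | yes _ = i , j
... | no  _ = j , i

edge-comm : ∀ (i j : Fin n) → edge i j ≡ edge j i
edge-comm i j with i <? j | j <? i
... | yes i<j | yes j<i = contradiction j<i (<-asym i<j)
... | yes _   | no  _   = refl
... | no  _   | yes _   = refl
... | no  i≮j | no  j≮i = cong₂ _,_ (sym i≡j) i≡j
  where
  i≡j = ≤-antisym (≮⇒≥ j≮i) (≮⇒≥ i≮j)

edge-sorted : ∀ {i j : Fin n} → i Fin.< j → edge i j ≡ (i , j)
edge-sorted {i = i} {j} i<j with i <? j
... | yes _   = refl
... | no  i≮j = contradiction i<j i≮j

edge-∈-upperPairs : ∀ {i j : Fin n} → i ≢ j → edge i j ∈ upperPairs n
edge-∈-upperPairs {i = i} {j} i≢j with i <? j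
... | yes i<j = ∈-upperPairs⁺ i<j
... | no  i≮j = ∈-upperPairs⁺ (≤∧≢⇒< (≮⇒≥ i≮j) (i≢j ∘ sym))

SameEdge : Fin n → Fin n → Fin n → Fin n → Set
SameEdge v o i j = (v ≡ i × o ≡ j) ⊎ (v ≡ j × o ≡ i)

SameEdge-sym : ∀ {X : Set} (h : Fin n → Fin n → X) → (∀ i j → h i j ≡ h j i) →
  ∀ {v o i j} → SameEdge v o i j → h v o ≡ h i j
SameEdge-sym h h-sym (inj₁ (refl , refl)) = refl
SameEdge-sym h h-sym (inj₂ (refl , refl)) = h-sym _ _

SameEdge-≢ : ∀ {v o i j : Fin n} → i ≢ j → SameEdge v o i j → v ≢ o
SameEdge-≢ i≢j (inj₁ (refl , refl)) = i≢j
SameEdge-≢ i≢j (inj₂ (refl , refl)) = i≢j ∘ sym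

edge-endpoints : ∀ (a b : Fin n) → SameEdge (proj₁ (edge a b)) (proj₂ (edge a b)) a b
edge-endpoints a b with a <? b
... | yes _ = inj₁ (refl , refl)
... | no  _ = inj₂ (refl , refl)

edge-injective : ∀ {a b c d : Fin n} → edge a b ≡ edge c d → SameEdge a b c d
edge-injective {a = a} {b} {c} {d} e with a <? b | c <? d
... | yes _ | yes _ = inj₁ (,-injective e)
... | yes _ | no  _ = inj₂ (,-injective e)
... | no  _ | yes _ with ,-injective e
...   | b≡c , a≡d = inj₂ (a≡d , b≡c)
edge-injective e | no _ | no _ with ,-injective e
...   | b≡d , a≡c = inj₁ (a≡c , b≡d)

_∩_ : EdgeSet n → EdgeSet n → EdgeSet n
(b ∩ d) i j = b i j ∧ d i j

_∖_ : EdgeSet n → EdgeSet n → EdgeSet n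
(b ∖ d) i j = b i j ∧ not (d i j)

edgeCount-split : ∀ (b d : EdgeSet n) → edgeCount b ≡ edgeCount (b ∩ d) + edgeCount (b ∖ d)
edgeCount-split {n} b d =
  count-split (λ e → b (proj₁ e) (proj₂ e)) (λ e → d (proj₁ e) (proj₂ e)) (upperPairs n)

edgeCount-cong : ∀ {b b' : EdgeSet n} → (∀ i j → b i j ≡ b' i j) → edgeCount b ≡ edgeCount b'
edgeCount-cong {n} b≗b' = count-cong (upperPairs n) (λ e → b≗b' (proj₁ e) (proj₂ e))

covered⁺ : ∀ {b : EdgeSet n} {i j} → i ≢ j → b i j ≡ true → covered b i ≡ true
covered⁺ {b = b} {i} i≢j bij = to T-≡ (any⁺ (λ k → b i k ∧ not ⌊ i ≟ k ⌋) (lose (∈-allFin _)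
  (from T-∧ (from T-≡ bij , fromWitnessFalse i≢j))))

uncovered≢covered : ∀ {b : EdgeSet n} {w v} → covered b w ≡ false → covered b v ≡ true → w ≢ v
uncovered≢covered w∉ v∈ refl with () ← trans (sym w∉) v∈

uncovered-isolated : ∀ {b : EdgeSet n} {w v} → covered b w ≡ false → w ≢ v → b w v ≡ false
uncovered-isolated {b = b} {w} {v} w∉ w≢v with b w v in bwv
... | false = refl
... | true with () ← trans (sym w∉) (covered⁺ {b = b} w≢v bwv)

uncoveredVertices : EdgeSet n → List (Fin n)
uncoveredVertices {n} b = filterᵇ (not ∘ covered b) (allFin n)

uncoveredVertices-unique : ∀ (b : EdgeSet n) → Unique (uncoveredVertices b)
uncoveredVertices-unique {n} b = Unique.filter⁺ (T? ∘ not ∘ covered b) (Unique.allFin⁺ n)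

∈-uncoveredVertices⁻ : ∀ {b : EdgeSet n} {w} → w ∈ uncoveredVertices b → covered b w ≡ false
∈-uncoveredVertices⁻ {n} {b} w∈ =
  to T-not-≡ (proj₂ (∈-filter⁻ (T? ∘ not ∘ covered b) {xs = allFin n} w∈))

length-uncoveredVertices : ∀ (b : EdgeSet n) → length (uncoveredVertices b) ≡ n ∸ vertexCount b
length-uncoveredVertices {n} b = begin
  length (uncoveredVertices b)                     ≡⟨ count≡length-filterᵇ (not ∘ covered b) (allFin n) ⟨
  count (not ∘ covered b) (allFin n)               ≡⟨ m+n∸m≡n (vertexCount b) _ ⟨
  vertexCount b + count (not ∘ covered b) (allFin n) ∸ vertexCount b
    ≡⟨ cong (_∸ vertexCount b) (trans (count-complement (covered b) (allFin n)) (length-tabulate _)) ⟩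
  n ∸ vertexCount b                                ∎
  where open ≡-Reasoning

pathSign-negate : ∀ (s t : Signature n) xs → pathSign (negate s t) xs ≡ pathSign s xs xor pathSign t xs
pathSign-negate s t []          = refl
pathSign-negate s t (x ∷ [])    = refl
pathSign-negate s t (x ∷ y ∷ r) = trans (cong (negate s t x y xor_) (pathSign-negate s t (y ∷ r)))
  (interchange (s x y) (t x y) (pathSign s (y ∷ r)) (pathSign t (y ∷ r)))

circleSign-negate : ∀ (s t : Signature n) vs →
  circleSign (negate s t) vs ≡ circleSign s vs xor circleSign t vs
circleSign-negate s t []       = refl
circleSign-negate s t (v ∷ vs) = pathSign-negate s t (v ∷ vs ++ v ∷ [])

xor-cancelˡ : ∀ a b c → (a xor b) xor (a xor c) ≡ b xor c
xor-cancelˡ a b c = trans (interchange a b a c) (cong (_xor (b xor c)) (xor-same a))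

balanced-symmetricDifference : ∀ {σ b b' : Signature n} →
  IsNegationSet σ b → IsNegationSet σ b' → Balanced (negate b b')
balanced-symmetricDifference {σ = σ} {b} {b'} b-neg b'-neg vs vs! 3≤∣vs∣ = begin
  circleSign (negate b b') vs                                 ≡⟨ circleSign-negate b b' vs ⟩
  circleSign b vs xor circleSign b' vs                        ≡⟨ xor-cancelˡ (circleSign σ vs) _ _ ⟨
  (circleSign σ vs xor circleSign b vs) xor (circleSign σ vs xor circleSign b' vs)
    ≡⟨ cong₂ _xor_ (circleSign-negate σ b vs) (circleSign-negate σ b' vs) ⟨
  circleSign (negate σ b) vs xor circleSign (negate σ b') vs
    ≡⟨ cong₂ _xor_ (b-neg vs vs! 3≤∣vs∣) (b'-neg vs vs! 3≤∣vs∣) ⟩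
  false                                                       ∎
  where open ≡-Reasoning

balanced-triangle : ∀ {t : Signature n} {i j k} → Balanced t → i ≢ j → i ≢ k → j ≢ k →
  t i j ≡ true → t k i ≡ not (t j k)
balanced-triangle {t = t} {i} {j} {k} t-bal i≢j i≢k j≢k tij =
  odd-triangle tij (t-bal (i ∷ j ∷ k ∷ []) ((i≢j ∷ i≢k ∷ []) ∷ (j≢k ∷ []) ∷ [] ∷ []) (s≤s (s≤s (s≤s z≤n))))
  where
  odd-triangle : ∀ {a b c} → a ≡ true → a xor (b xor (c xor false)) ≡ false → c ≡ not b
  odd-triangle {b = false} {true}  refl _ = refl
  odd-triangle {b = true}  {false} refl _ = refl
  odd-triangle {b = false} {false} refl ()
  odd-triangle {b = true}  {true}  refl ()

-- Injecting B ∩ D into D ∖ B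

module _ {B D : EdgeSet n} (B-sym : SymmetricEdges B) (D-sym : SymmetricEdges D)
  (D-balanced : Balanced D) {χ} (B-colouring : Colorable B χ)
  (χ≤∣uncovered∣ : χ ≤ n ∸ vertexCount B) where

  private
    col : Fin n → Fin n → ℕ
    col = proj₁ B-colouring

    col-sym : ∀ i j → col i j ≡ col j i
    col-sym = proj₁ (proj₂ B-colouring)

    col-bounded : ∀ i j → i ≢ j → B i j ≡ true → col i j < χ
    col-bounded = proj₁ (proj₂ (proj₂ B-colouring))

    col-proper : ∀ i j k → i ≢ j → i ≢ k → j ≢ k → B i j ≡ true → B i k ≡ true → col i j ≢ col i k
    col-proper = proj₂ (proj₂ (proj₂ B-colouring))

    U : List (Fin n)
    U = uncoveredVertices B

    -- The default i is never reached for edges of B, whose colours are < χ ≤ length U.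
    witness : Fin n → Fin n → Fin n
    witness i j = lookupOr i U (col i j)

    near far : Fin n → Fin n → Fin n
    near i j = if D (witness i j) j then j else i
    far  i j = if D (witness i j) j then i else j

    near-far : ∀ i j → SameEdge (near i j) (far i j) i j
    near-far i j with D (witness i j) j
    ... | true  = inj₂ (refl , refl)
    ... | false = inj₁ (refl , refl)

    image : Fin n × Fin n → Fin n × Fin n
    image (i , j) = edge (witness i j) (near i j)

    colour-class-matching : ∀ {v o o'} → v ≢ o → v ≢ o' → B v o ≡ true → B v o' ≡ true →
      col v o ≡ col v o' → o ≡ o'
    colour-class-matching {v} {o} {o'} v≢o v≢o' vo∈B vo'∈B same-colour with o ≟ o'
    ... | yes o≡o' = o≡o'
    ... | no  o≢o' = contradiction same-colour (col-proper v o o' v≢o v≢o' o≢o' vo∈B vo'∈B)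

    module EdgeOfB∩D {i j : Fin n} (ij∈Kₙ : (i , j) ∈ upperPairs n)
      (ij∈B∩D : (B ∩ D) i j ≡ true) where

      i<j : i Fin.< j
      i<j = ∈-upperPairs⁻ ij∈Kₙ

      i≢j : i ≢ j
      i≢j = <⇒≢ i<j

      ij∈B : B i j ≡ true
      ij∈B = ∧-conicalˡ _ _ ij∈B∩D

      ij∈D : D i j ≡ true
      ij∈D = ∧-conicalʳ _ _ ij∈B∩D

      col<∣U∣ : col i j < length U
      col<∣U∣ = <-≤-trans (col-bounded i j i≢j ij∈B)
        (subst (χ ≤_) (sym (length-uncoveredVertices B)) χ≤∣uncovered∣)

      witness-uncovered : covered B (witness i j) ≡ false
      witness-uncovered = ∈-uncoveredVertices⁻ {b = B} (lookupOr-∈ col<∣U∣)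

      witness≢ : ∀ {v} → covered B v ≡ true → witness i j ≢ v
      witness≢ = uncovered≢covered {b = B} witness-uncovered

      near-far∈B : B (near i j) (far i j) ≡ true
      near-far∈B = trans (SameEdge-sym B B-sym (near-far i j)) ij∈B

      near≢far : near i j ≢ far i j
      near≢far = SameEdge-≢ i≢j (near-far i j)

      near-covered : covered B (near i j) ≡ true
      near-covered = covered⁺ {b = B} near≢far near-far∈B

      witness≢near : witness i j ≢ near i j
      witness≢near = witness≢ near-covered

      witness-near∈D : D (witness i j) (near i j) ≡ true
      witness-near∈D with D (witness i j) j in wj∈D
      ... | true  = wj∈D
      ... | false = trans (balanced-triangle D-balanced i≢j (witness≢ i-covered ∘ sym)
                             (witness≢ j-covered ∘ sym) ij∈D)
                          (cong not (trans (D-sym j (witness i j)) wj∈D))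
        where
        i-covered : covered B i ≡ true
        i-covered = covered⁺ {b = B} i≢j ij∈B
        j-covered : covered B j ≡ true
        j-covered = covered⁺ {b = B} (i≢j ∘ sym) (trans (B-sym j i) ij∈B)

      image∈D∖B : (D ∖ B) (witness i j) (near i j) ≡ true
      image∈D∖B = cong₂ _∧_ witness-near∈D
        (cong not (uncovered-isolated {b = B} witness-uncovered witness≢near))

    image-into : ∀ {e} → e ∈ upperPairs n → (B ∩ D) (proj₁ e) (proj₂ e) ≡ true →
      image e ∈ upperPairs n × (D ∖ B) (proj₁ (image e)) (proj₂ (image e)) ≡ true
    image-into {i , j} ij∈Kₙ ij∈B∩D =
      edge-∈-upperPairs witness≢near , trans (SameEdge-sym (D ∖ B) D∖B-sym (edge-endpoints _ _)) image∈D∖B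
      where
      open EdgeOfB∩D ij∈Kₙ ij∈B∩D
      D∖B-sym : ∀ a b → (D ∖ B) a b ≡ (D ∖ B) b a
      D∖B-sym a b = cong₂ _∧_ (D-sym a b) (cong not (B-sym a b))

    witness-near-injective : ∀ {i j i' j'} → (i , j) ∈ upperPairs n → (i' , j') ∈ upperPairs n →
      (B ∩ D) i j ≡ true → (B ∩ D) i' j' ≡ true →
      witness i j ≡ witness i' j' → near i j ≡ near i' j' → (i , j) ≡ (i' , j')
    witness-near-injective {i} {j} {i'} {j'} ij∈Kₙ i'j'∈Kₙ ij∈B∩D i'j'∈B∩D w≡w' v≡v' = begin
      (i , j)               ≡⟨ edge-sorted ij.i<j ⟨
      edge i j              ≡⟨ SameEdge-sym edge edge-comm (near-far i j) ⟨
      edge v (far i j)      ≡⟨ cong (edge v) o≡o' ⟩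
      edge v (far i' j')    ≡⟨ cong (λ u → edge u (far i' j')) v≡v' ⟩
      edge v' (far i' j')   ≡⟨ SameEdge-sym edge edge-comm (near-far i' j') ⟩
      edge i' j'            ≡⟨ edge-sorted i'j'.i<j ⟩
      (i' , j')             ∎
      where
      open ≡-Reasoning
      module ij   = EdgeOfB∩D ij∈Kₙ ij∈B∩D
      module i'j' = EdgeOfB∩D i'j'∈Kₙ i'j'∈B∩D
      v v' : Fin n
      v  = near i j
      v' = near i' j'
      same-colour : col i j ≡ col i' j'
      same-colour = lookupOr-injective (uncoveredVertices-unique B) ij.col<∣U∣ i'j'.col<∣U∣ w≡w'
      o≡o' : far i j ≡ far i' j'
      o≡o' = colour-class-matching ij.near≢far (subst (_≢ far i' j') (sym v≡v') i'j'.near≢far)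
        ij.near-far∈B (subst (λ u → B u (far i' j') ≡ true) (sym v≡v') i'j'.near-far∈B)
        (begin
          col v (far i j)    ≡⟨ SameEdge-sym col col-sym (near-far i j) ⟩
          col i j            ≡⟨ same-colour ⟩
          col i' j'          ≡⟨ SameEdge-sym col col-sym (near-far i' j') ⟨
          col v' (far i' j') ≡⟨ cong (λ u → col u (far i' j')) v≡v' ⟨
          col v (far i' j')  ∎)

    image-injective : ∀ {e e'} → e ∈ upperPairs n → e' ∈ upperPairs n →
      (B ∩ D) (proj₁ e) (proj₂ e) ≡ true → (B ∩ D) (proj₁ e') (proj₂ e') ≡ true →
      image e ≡ image e' → e ≡ e'
    image-injective ij∈Kₙ i'j'∈Kₙ ij∈B∩D i'j'∈B∩D same-image with edge-injective same-image
    ... | inj₁ (w≡w' , v≡v') = witness-near-injective ij∈Kₙ i'j'∈Kₙ ij∈B∩D i'j'∈B∩D w≡w' v≡v'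
    ... | inj₂ (w≡v' , _)    = contradiction w≡v'
      (EdgeOfB∩D.witness≢ ij∈Kₙ ij∈B∩D (EdgeOfB∩D.near-covered i'j'∈Kₙ i'j'∈B∩D))

  edgeCount-∩≤∖ : edgeCount (B ∩ D) ≤ edgeCount (D ∖ B)
  edgeCount-∩≤∖ = count-mono-injection {p = λ e → (B ∩ D) (proj₁ e) (proj₂ e)}
    {q = λ e → (D ∖ B) (proj₁ e) (proj₂ e)} image (upperPairs-unique n) image-into image-injective

symmetricDifference-∩ : ∀ x y → y ∧ (x xor y) ≡ (x xor y) ∧ not x
symmetricDifference-∩ false false = refl
symmetricDifference-∩ false true  = refl
symmetricDifference-∩ true  false = refl
symmetricDifference-∩ true  true  = refl

symmetricDifference-∖ : ∀ x y → y ∧ not (x xor y) ≡ x ∧ not (x xor y)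
symmetricDifference-∖ false false = refl
symmetricDifference-∖ false true  = refl
symmetricDifference-∖ true  false = refl
symmetricDifference-∖ true  true  = refl

proposition2p3 : (n : ℕ) (σ : Signature n) → SymmetricSig σ →
    (B : EdgeSet n) → SymmetricEdges B → IsNegationSet σ B →
    (χ : ℕ) → IsChromaticIndex B χ → χ ≤ n ∸ vertexCount B →
    IsMinimumNegationSet σ B
proposition2p3 n σ _ B B-sym B-neg χ (B-colouring , _) χ≤∣uncovered∣ = B-neg , B-minimum
  where
  B-minimum : ∀ B' → SymmetricEdges B' → IsNegationSet σ B' → edgeCount B ≤ edgeCount B'
  B-minimum B' B'-sym B'-neg = begin
    edgeCount B                               ≡⟨ edgeCount-split B D ⟩
    edgeCount (B ∩ D) + edgeCount (B ∖ D)     ≤⟨ +-monoˡ-≤ _ (edgeCount-∩≤∖ B-sym D-sym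
                                                   (balanced-symmetricDifference {σ = σ} B-neg B'-neg)
                                                   B-colouring χ≤∣uncovered∣) ⟩
    edgeCount (D ∖ B) + edgeCount (B ∖ D)     ≡⟨ cong₂ _+_
                                                   (edgeCount-cong λ i j → symmetricDifference-∩ (B i j) (B' i j))
                                                   (edgeCount-cong λ i j → symmetricDifference-∖ (B i j) (B' i j)) ⟨
    edgeCount (B' ∩ D) + edgeCount (B' ∖ D)   ≡⟨ edgeCount-split B' D ⟨
    edgeCount B'                              ∎
    where
    open ≤-Reasoning
    D : EdgeSet n
    D = negate B B'
    D-sym : SymmetricEdges D
    D-sym i j = cong₂ _xor_ (B-sym i j) (B'-sym i j)
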